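{- Let $q_1<q_2$ be primes and let $p$ be a prime with $p\geq q_1^2q_2^2$. Then there exist positive integers $u,v$ such that $p=uq_1+vq_2$, $q_1\nmid u$, and $q_2\nmid v$. -}

module Defs where

{-# OPTIONS --safe #-}
-- Since gcd(q₁, q₂) = 1,
-- every N ≥ q₁q₂ is u q₁ + v q₂ with u, v ≥ 0 (take u < q₂ with u q₁ ≡ N mod q₂, from a
-- Bézout identity). Apply this to p − (q₁ + q₁²) q₂, keeping q₁ + q₁² copies of q₂ in
-- reserve; p ≥ q₁²q₂² ≥ (q₁ + 2) q₁q₂ leaves room for that. If q₁ ∣ u, trade q₁ copies of q₂
-- for q₂ more copies of q₁; as q₁ ∤ q₂ this makes u prime to q₁. Then q₂ cannot divide both
-- v and v + q₁², because q₂ ∤ q₁²; in the bad case, trading the remaining q₁² copies of q₂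
-- for q₁q₂ copies of q₁ keeps u prime to q₁.
module Submission where

open import Defs
open import Data.Nat using (ℕ; _+_; _*_; _<_; _≥_)
open import Data.Nat.Divisibility using (_∣_)
open import Data.Nat.Primality using (Prime)
open import Data.Product using (_×_; ∃₂)
open import Relation.Nullary using (¬_)
open import Relation.Binary.PropositionalEquality using (_≡_)

open import Data.Nat using (_≤_; _∸_; NonZero; >-nonZero; nonTrivial⇒n>1)
open import Data.Nat.Properties
open import Data.Nat.DivMod using (_%_; _/_; m%n<n; m≡m%n+[m/n]*n)
open import Data.Nat.Divisibility
  using (_∤_; _∣?_; ∣-refl; ∣m+n∣m⇒∣n; ∣m⇒∣m*n; n∣m*n; m∣m*n; _∣0)
open import Data.Nat.Primality using (prime⇒nonZero; prime⇒nonTrivial)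
open import Data.Nat.Coprimality using (Coprime; coprime-Bézout; coprime-divisor; prime⇒coprime)
import Data.Nat.Coprimality as Coprimality
open import Data.Nat.GCD using (module Bézout)
open import Data.Nat.Tactic.RingSolver using (solve)
open import Data.List using (_∷_; [])
open import Data.Product using (_,_)
open import Data.Sum using (_⊎_; inj₁; inj₂)
open import Relation.Nullary using (yes; no)
open import Relation.Binary.PropositionalEquality
  using (refl; sym; trans; cong; subst; module ≡-Reasoning)

private
  variable
    a b d m n N : ℕ

Representation : ℕ → ℕ → ℕ → Set
Representation a b N = ∃₂ λ u v → N ≡ u * a + v * b

AvoidingRepresentation : ℕ → ℕ → ℕ → Set
AvoidingRepresentation a b N = ∃₂ λ u v → N ≡ u * a + v * b × a ∤ u × b ∤ v

∤⇒>0 : d ∤ n → 0 < n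
∤⇒>0 {d} d∤n = n≢0⇒n>0 λ { refl → d∤n (d ∣0) }

avoiding⇒positive : AvoidingRepresentation a b N →
                    ∃₂ λ u v → 0 < u × 0 < v × N ≡ u * a + v * b × a ∤ u × b ∤ v
avoiding⇒positive (u , v , N≡ua+vb , a∤u , b∤v) =
  u , v , ∤⇒>0 a∤u , ∤⇒>0 b∤v , N≡ua+vb , a∤u , b∤v

∤m⇒∤n⊎∤n+m : d ∤ m → ∀ n → d ∤ n ⊎ d ∤ n + m
∤m⇒∤n⊎∤n+m {d} d∤m n with d ∣? n
... | no  d∤n = inj₁ d∤n
... | yes d∣n = inj₂ λ d∣n+m → d∤m (∣m+n∣m⇒∣n d∣n+m d∣n)

∤m⇒∤m+d*n : d ∤ m → ∀ n → d ∤ m + d * n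
∤m⇒∤m+d*n {d} {m} d∤m n d∣m+dn =
  d∤m (∣m+n∣m⇒∣n (subst (d ∣_) (+-comm m (d * n)) d∣m+dn) (m∣m*n n))

coprime⇒∤ : Coprime m n → 1 < m → m ∤ n
coprime⇒∤ coprime 1<m m∣n = >⇒≢ 1<m (coprime (∣-refl , m∣n))

inverse⇒representation : ∀ {a b N} .{{_ : NonZero b}} →
                         (∃₂ λ x y → x * a ≡ 1 + y * b) → a * b ≤ N → Representation a b N
inverse⇒representation {a} {b} {N} (x , y , xa≡1+yb) ab≤N =
  r , v , sym N≡ra+vb
  where
  open ≡-Reasoning
  r q w : ℕ
  r = (N * x) % b
  q = (N * x) / b
  w = N ∸ r * a

  ra≤N : r * a ≤ N
  ra≤N = ≤-trans (*-monoˡ-≤ a (<⇒≤ (m%n<n (N * x) b)))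
                 (≤-trans (≤-reflexive (*-comm b a)) ab≤N)

  ra+w≡N : r * a + w ≡ N
  ra+w≡N = m+[n∸m]≡n ra≤N

  Nyb+w≡qba : N * y * b + w ≡ q * b * a
  Nyb+w≡qba = +-cancelˡ-≡ (r * a) _ _ (begin
    r * a + (N * y * b + w)  ≡⟨ cong (r * a +_) (+-comm (N * y * b) w) ⟩
    r * a + (w + N * y * b)  ≡⟨ sym (+-assoc (r * a) w _) ⟩
    r * a + w + N * y * b    ≡⟨ cong (_+ N * y * b) ra+w≡N ⟩
    N + N * y * b            ≡⟨ solve (N ∷ y ∷ b ∷ []) ⟩
    N * (1 + y * b)          ≡⟨ cong (N *_) (sym xa≡1+yb) ⟩
    N * (x * a)              ≡⟨ sym (*-assoc N x a) ⟩
    N * x * a                ≡⟨ cong (_* a) (m≡m%n+[m/n]*n (N * x) b) ⟩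
    (r + q * b) * a          ≡⟨ *-distribʳ-+ a r (q * b) ⟩
    r * a + q * b * a        ∎)

  b∣w : b ∣ w
  b∣w = ∣m+n∣m⇒∣n (subst (b ∣_) (sym Nyb+w≡qba) (∣m⇒∣m*n a (n∣m*n q)))
                  (n∣m*n (N * y))

  open _∣_ b∣w using () renaming (quotient to v; equality to w≡vb)

  N≡ra+vb : r * a + v * b ≡ N
  N≡ra+vb = trans (cong (r * a +_) (sym w≡vb)) ra+w≡N

coprime⇒representation : .{{_ : NonZero a}} .{{_ : NonZero b}} →
                         Coprime a b → a * b ≤ N → Representation a b N
coprime⇒representation {a} {b} {N} coprime ab≤N with coprime-Bézout coprime
... | Bézout.+- x y 1+yb≡xa = inverse⇒representation (x , y , sym 1+yb≡xa) ab≤N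
... | Bézout.-+ x y 1+xa≡yb
  with v , u , N≡vb+ua ← inverse⇒representation (y , x , sym 1+xa≡yb)
                                                (subst (_≤ N) (*-comm a b) ab≤N)
  = u , v , trans N≡vb+ua (+-comm (v * b) (u * a))

reserve-a*a⇒avoiding : ∀ {a b u} → b ∤ a * a → a ∤ u → ∀ v →
                       AvoidingRepresentation a b (u * a + (v + a * a) * b)
reserve-a*a⇒avoiding {a} {b} {u} b∤aa a∤u v with ∤m⇒∤n⊎∤n+m b∤aa v
... | inj₂ b∤v+aa = u , v + a * a , refl , a∤u , b∤v+aa
... | inj₁ b∤v    = u + a * b , v , solve (u ∷ v ∷ a ∷ b ∷ []) , ∤m⇒∤m+d*n a∤u b , b∤v

reserve-a+a*a⇒avoiding : a ∤ b → b ∤ a * a → ∀ u v →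
                         AvoidingRepresentation a b (u * a + (v + a + a * a) * b)
reserve-a+a*a⇒avoiding {a} {b} a∤b b∤aa u v with ∤m⇒∤n⊎∤n+m a∤b u
... | inj₁ a∤u   = reserve-a*a⇒avoiding b∤aa a∤u (v + a)
... | inj₂ a∤u+b =
  subst (AvoidingRepresentation a b) trade (reserve-a*a⇒avoiding b∤aa a∤u+b v)
  where
  trade : (u + b) * a + (v + a * a) * b ≡ u * a + (v + a + a * a) * b
  trade = solve (u ∷ v ∷ a ∷ b ∷ [])

coprime⇒avoidingRepresentation : Coprime a b → 1 < a → 1 < b →
                                 a * b + (a + a * a) * b ≤ N → AvoidingRepresentation a b N
coprime⇒avoidingRepresentation {a} {b} {N} coprime 1<a 1<b bound
  with u , v , N'≡ua+vb ← coprime⇒representation {{>-nonZero (<⇒≤ 1<a)}}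
                                                {{>-nonZero (<⇒≤ 1<b)}}
                                                coprime (m+n≤o⇒m≤o∸n (a * b) bound)
  = subst (AvoidingRepresentation a b) N≡ (reserve-a+a*a⇒avoiding a∤b b∤aa u v)
  where
  a∤b : a ∤ b
  a∤b = coprime⇒∤ coprime 1<a

  b∤aa : b ∤ a * a
  b∤aa b∣aa = coprime⇒∤ coprime′ 1<b (coprime-divisor coprime′ b∣aa)
    where
    coprime′ : Coprime b a
    coprime′ = Coprimality.sym coprime

  open ≡-Reasoning
  N≡ : u * a + (v + a + a * a) * b ≡ N
  N≡ = begin
    u * a + (v + a + a * a) * b              ≡⟨ solve (u ∷ v ∷ a ∷ b ∷ []) ⟩
    (a + a * a) * b + (u * a + v * b)        ≡⟨ cong ((a + a * a) * b +_) (sym N'≡ua+vb) ⟩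
    (a + a * a) * b + (N ∸ (a + a * a) * b)  ≡⟨ m+[n∸m]≡n (m+n≤o⇒n≤o (a * b) bound) ⟩
    N                                        ∎

a*b+[a+a*a]*b≤a*a*[b*b] : 1 < a → 1 < b → a * b + (a + a * a) * b ≤ a * a * (b * b)
a*b+[a+a*a]*b≤a*a*[b*b] {a} {b} 2≤a 2≤b = begin
  a * b + (a + a * a) * b  ≡⟨ solve (a ∷ b ∷ []) ⟩
  (2 + a) * (a * b)        ≤⟨ *-monoˡ-≤ (a * b) 2+a≤ab ⟩
  (a * b) * (a * b)        ≡⟨ solve (a ∷ b ∷ []) ⟩
  a * a * (b * b)          ∎
  where
  open ≤-Reasoning
  2+a≤ab : 2 + a ≤ a * b
  2+a≤ab = begin
    2 + a  ≤⟨ +-monoˡ-≤ a 2≤a ⟩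
    a + a  ≡⟨ solve (a ∷ []) ⟩
    a * 2  ≤⟨ *-monoʳ-≤ a 2≤b ⟩
    a * b  ∎

prime⇒>1 : Prime n → 1 < n
prime⇒>1 {n} n-prime = nonTrivial⇒n>1 n {{prime⇒nonTrivial n-prime}}

lemma3 : ∀ (q₁ q₂ p : ℕ) → Prime q₁ → Prime q₂ → q₁ < q₂ → Prime p →
         p ≥ q₁ * q₁ * (q₂ * q₂) →
         ∃₂ λ (u v : ℕ) → 0 < u × 0 < v × p ≡ u * q₁ + v * q₂ × ¬ (q₁ ∣ u) × ¬ (q₂ ∣ v)
lemma3 q₁ q₂ p q₁-prime q₂-prime q₁<q₂ _ p≥q₁²q₂² =
  avoiding⇒positive (coprime⇒avoidingRepresentation coprime 1<q₁ 1<q₂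
                       (≤-trans (a*b+[a+a*a]*b≤a*a*[b*b] 1<q₁ 1<q₂) p≥q₁²q₂²))
  where
  1<q₁ : 1 < q₁
  1<q₁ = prime⇒>1 q₁-prime
  1<q₂ : 1 < q₂
  1<q₂ = prime⇒>1 q₂-prime
  coprime : Coprime q₁ q₂
  coprime = Coprimality.sym (prime⇒coprime q₂-prime {{prime⇒nonZero q₁-prime}} q₁<q₂)
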